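{- For every $k\in\mathbb{N}$, the poset $I_1[k]$ is normal and rank-log concave.
   Context: $I_1$ is the three-element poset $\{\varnothing,\{1\},\{1'\}\}$ with $\varnothing<\{1\}$, $\varnothing<\{1'\}$ and $\{1\},\{1'\}$ incomparable. For a poset $(P,\leq)$ and $k\in\mathbb{N}$, $P[k] = \{(x_1 \leq x_2 \leq \dotsb \leq x_k) \mid x_i \in P\}$ (multichains, repetitions allowed), ordered by $(x_1 \leq \dotsb \leq x_k) \leq_k (x'_1 \leq \dotsb \leq x'_k)$ iff $x_i \leq x'_i$ for all $i$; it is graded with rank $\rho(x_1\le\dots\le x_k)=\sum_i\rho(x_i)$, ranks starting at $0$ on minimal elements. For a graded poset $P$ of rank $n$ let $P_i=\{x\in P:\rho(x)=i\}$, and for $A\subseteq P$ let $\nabla(A)$ be the set of elements of $P$ covering some element of $A$. $P$ is normal if $|A|/|P_i|\leq|\nabla(A)|/|P_{i+1}|$ for all $A\subseteq P_i$ and $i=0,\dots,n-1$. $P$ is rank-log concave if $|P_i|^2\geq|P_{i-1}||P_{i+1}|$ for $i=1,\dots,n-1$. -}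

module Defs where

open import Data.Nat using (ℕ; zero; suc; _+_; _*_; _∸_; _≤_; _<_; _⊔_)
open import Data.Bool using (Bool; true; false)
open import Data.Product using (_×_; _,_)
open import Data.Unit using (⊤; tt)
open import Data.List using (List; []; _∷_; filter; length; foldr; map; concatMap)
open import Data.List.Relation.Unary.Any using (Any; any?)
open import Data.Vec using (Vec; []; _∷_)
import Data.Vec.Properties as VecP
open import Data.Vec.Relation.Binary.Pointwise.Inductive as PW using (Pointwise)
open import Relation.Nullary using (¬_; Dec; yes; no; _×-dec_; ¬?)
open import Relation.Nullary.Decidable using (⌊_⌋)
open import Relation.Binary using (Decidable; DecidableEquality)
open import Relation.Binary.PropositionalEquality using (_≡_; _≢_; refl)
open import Data.Nat.Properties using (_≟_)

record FinGradedPoset : Set₁ where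
  field
    Carrier : Set
    _≼_     : Carrier → Carrier → Set
    _≟ₚ_    : DecidableEquality Carrier
    _≼?_    : Decidable _≼_
    elems   : List Carrier          -- all elements, each exactly once
    rank    : Carrier → ℕ

  _≺_ : Carrier → Carrier → Set
  x ≺ y = (x ≼ y) × (x ≢ y)

  _≺?_ : Decidable _≺_
  x ≺? y = (x ≼? y) ×-dec ¬? (x ≟ₚ y)

  _⋖_ : Carrier → Carrier → Set
  x ⋖ y = (x ≺ y) × ¬ Any (λ z → (x ≺ z) × (z ≺ y)) elems

  _⋖?_ : Decidable _⋖_
  x ⋖? y = (x ≺? y) ×-dec ¬? (any? (λ z → (x ≺? z) ×-dec (z ≺? y)) elems)

  rankP : ℕ
  rankP = foldr _⊔_ 0 (map rank elems)

  level : ℕ → List Carrier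
  level i = filter (λ x → rank x ≟ i) elems

  ∣P_∣ : ℕ → ℕ
  ∣P i ∣ = length (level i)

  subsetOf : ℕ → (Carrier → Bool) → List Carrier
  subsetOf i A = filter (λ x → A x Data.Bool.≟ true) (level i)

  ∇ : List Carrier → List Carrier
  ∇ As = filter (λ y → any? (λ x → x ⋖? y) As) elems

  -- normal: |A|/|P_i| ≤ |∇A|/|P_{i+1}|, written cross-multiplied
  Normal : Set
  Normal = ∀ (i : ℕ) → i < rankP → ∀ (A : Carrier → Bool) →
    length (subsetOf i A) * ∣P suc i ∣ ≤ length (∇ (subsetOf i A)) * ∣P i ∣

  RankLogConcave : Set
  RankLogConcave = ∀ (i : ℕ) → 1 ≤ i → i < rankP →
    ∣P i ∸ 1 ∣ * ∣P suc i ∣ ≤ ∣P i ∣ * ∣P i ∣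

data I₁ : Set where
  ∅ e₁ e₁' : I₁

data _≤I_ : I₁ → I₁ → Set where
  ∅≤   : ∀ {x} → ∅ ≤I x
  e≤e  : e₁ ≤I e₁
  e'≤e' : e₁' ≤I e₁'

_≤I?_ : Decidable _≤I_
∅ ≤I? _ = yes ∅≤
e₁ ≤I? ∅ = no λ ()
e₁ ≤I? e₁ = yes e≤e
e₁ ≤I? e₁' = no λ ()
e₁' ≤I? ∅ = no λ ()
e₁' ≤I? e₁ = no λ ()
e₁' ≤I? e₁' = yes e'≤e'

_≟I_ : DecidableEquality I₁
∅ ≟I ∅ = yes refl
∅ ≟I e₁ = no λ ()
∅ ≟I e₁' = no λ ()
e₁ ≟I ∅ = no λ ()
e₁ ≟I e₁ = yes refl
e₁ ≟I e₁' = no λ ()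
e₁' ≟I ∅ = no λ ()
e₁' ≟I e₁ = no λ ()
e₁' ≟I e₁' = yes refl

ρI : I₁ → ℕ
ρI ∅ = 0
ρI e₁ = 1
ρI e₁' = 1

allI₁ : List I₁
allI₁ = ∅ ∷ e₁ ∷ e₁' ∷ []

IsMultichain : ∀ {k} → Vec I₁ k → Set
IsMultichain [] = ⊤
IsMultichain (x ∷ []) = ⊤
IsMultichain (x ∷ y ∷ xs) = (x ≤I y) × IsMultichain (y ∷ xs)

isMultichain? : ∀ {k} (v : Vec I₁ k) → Dec (IsMultichain v)
isMultichain? [] = yes tt
isMultichain? (x ∷ []) = yes tt
isMultichain? (x ∷ y ∷ xs) = (x ≤I? y) ×-dec isMultichain? (y ∷ xs)

allVecs : (k : ℕ) → List (Vec I₁ k)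
allVecs zero = [] ∷ []
allVecs (suc k) = concatMap (λ x → map (x ∷_) (allVecs k)) allI₁

I₁[_] : ℕ → FinGradedPoset
I₁[ k ] = record
  { Carrier = Vec I₁ k
  ; _≼_ = Pointwise _≤I_
  ; _≟ₚ_ = VecP.≡-dec _≟I_
  ; _≼?_ = PW.decidable _≤I?_
  ; elems = filter isMultichain? (allVecs k)
  ; rank = λ v → Data.Vec.sum (Data.Vec.map ρI v)
  }

module Submission where

-- The proof computes I₁[k] explicitly.  A multichain in I₁ is a run of
-- ∅'s followed by a run of one atom, so the elements of I₁[k] are the
-- "towers" ∅…∅ x…x with i copies of an atom x, and the rank of a tower
-- is i.  Hence level 0 is the single bottom ∅…∅, each level 1 ≤ i ≤ k
-- consists of the two towers of height i, and the rank is strictly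
-- monotone, so raising a tower by one entry is a covering step.

open import Defs
open import Data.Nat using (ℕ; zero; suc; _*_; _∸_; _≤_; _<_; _⊔_; z≤n; s≤s; _<ᵇ_)
open import Data.Nat.Properties
open import Data.Bool using (Bool; true; false; if_then_else_)
import Data.Bool as Bool
open import Data.Product using (_×_; _,_; proj₁; proj₂)
open import Data.Unit using (tt)
open import Data.Empty using (⊥-elim)
open import Data.List using (List; []; _∷_; filter; length; foldr; map; _++_)
open import Data.List.Properties using (filter-++; filter-accept; filter-reject; filter-≐; filter-none; ++-identityʳ)
import Data.List.Relation.Unary.All as All
open import Data.List.Relation.Unary.Any using (Any; here; there; any?)
open import Data.List.Membership.Propositional using (_∈_; lose)
open import Data.List.Membership.Propositional.Properties using (∈-filter⁺; ∈-filter⁻)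
open import Data.Vec using (Vec; []; _∷_; replicate)
import Data.Vec as Vec
open import Data.Vec.Relation.Binary.Pointwise.Inductive using (Pointwise; []; _∷_)
open import Relation.Nullary using (¬_; yes; no; does)
open import Relation.Unary using (Pred; Decidable)
open import Relation.Binary.PropositionalEquality using (_≡_; _≢_; refl; sym; trans; cong; subst)
open import Function using (_∘_)

filter-map-comm : ∀ {a b p} {A : Set a} {B : Set b} {P : Pred B p} (P? : Decidable P) (f : A → B) (xs : List A) →
                  filter P? (map f xs) ≡ map f (filter (λ x → P? (f x)) xs)
filter-map-comm P? f [] = refl
filter-map-comm P? f (x ∷ xs) with does (P? (f x))
... | true  = cong (f x ∷_) (filter-map-comm P? f xs)
... | false = filter-map-comm P? f xs

length-≥1 : ∀ {A : Set} {x : A} {xs} → x ∈ xs → 1 ≤ length xs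
length-≥1 (here _) = s≤s z≤n
length-≥1 (there _) = s≤s z≤n

length-≥2 : ∀ {A : Set} {x y : A} {xs} → x ∈ xs → y ∈ xs → x ≢ y → 2 ≤ length xs
length-≥2 (here refl) (here refl) x≢y = ⊥-elim (x≢y refl)
length-≥2 (here refl) (there y∈xs) _ = s≤s (length-≥1 y∈xs)
length-≥2 (there x∈xs) _ _ = s≤s (length-≥1 x∈xs)

module Graded (P : FinGradedPoset) where
  open FinGradedPoset P

  rankP-≤ : ∀ {n} → (∀ x → rank x ≤ n) → rankP ≤ n
  rankP-≤ {n} bound = go elems
    where
    go : (xs : List Carrier) → foldr _⊔_ 0 (map rank xs) ≤ n
    go [] = z≤n
    go (x ∷ xs) = ⊔-lub (bound x) (go xs)

  cover-by-rank : (∀ {x y} → x ≺ y → rank x < rank y) →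
                  ∀ {x y} → x ≼ y → rank y ≡ suc (rank x) → x ⋖ y
  cover-by-rank strict {x} {y} x≼y ry≡1+rx = (x≼y , x≢y) , no-middle
    where
    x≢y : x ≢ y
    x≢y refl = 1+n≢n (sym ry≡1+rx)
    no-middle : ∀ {zs} → ¬ Any (λ z → (x ≺ z) × (z ≺ y)) zs
    no-middle (here {z} (x≺z , z≺y)) =
      <⇒≱ (strict x≺z) (≤-pred (subst (rank z <_) ry≡1+rx (strict z≺y)))
    no-middle (there rest) = no-middle rest

  ∈-∇ : ∀ {S x y} → y ∈ elems → x ∈ S → x ⋖ y → y ∈ ∇ S
  ∈-∇ y∈P x∈S x⋖y = ∈-filter⁺ (λ y → any? (λ x → x ⋖? y) _) y∈P (lose x∈S x⋖y)

  level⊆elems : ∀ {i y} → y ∈ level i → y ∈ elems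
  level⊆elems y∈Pᵢ = proj₁ (∈-filter⁻ (λ x → rank x ≟ _) y∈Pᵢ)

  NormalAt : ℕ → Set
  NormalAt i = ∀ (A : Carrier → Bool) →
    length (subsetOf i A) * ∣P suc i ∣ ≤ length (∇ (subsetOf i A)) * ∣P i ∣

  pair-level-members : ∀ {j a b} → level j ≡ a ∷ b ∷ [] → (a ∈ elems) × (b ∈ elems)
  pair-level-members Pⱼ =
    level⊆elems (subst (_ ∈_) (sym Pⱼ) (here refl)) ,
    level⊆elems (subst (_ ∈_) (sym Pⱼ) (there (here refl)))

  normal-at-singleton : ∀ {i z a b} → level i ≡ z ∷ [] → level (suc i) ≡ a ∷ b ∷ [] →
                        a ≢ b → z ⋖ a → z ⋖ b → NormalAt i
  normal-at-singleton {i} {z} {a} {b} Pᵢ Pᵢ₊₁ a≢b z⋖a z⋖b A rewrite Pᵢ | Pᵢ₊₁ with A z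
  ... | false = z≤n
  ... | true  = ≤-trans (length-≥2 (∈-∇ a∈P (here refl) z⋖a) (∈-∇ b∈P (here refl) z⋖b) a≢b)
                        (≤-reflexive (sym (*-identityʳ _)))
    where
    a∈P : a ∈ elems
    a∈P = proj₁ (pair-level-members Pᵢ₊₁)
    b∈P : b ∈ elems
    b∈P = proj₂ (pair-level-members Pᵢ₊₁)

  -- A two-element level matched by covers onto the next two-element
  -- level satisfies the normality inequality: A ↦ ∇A never shrinks.
  normal-at-pairs : ∀ {i a b a' b'} → level i ≡ a ∷ b ∷ [] → level (suc i) ≡ a' ∷ b' ∷ [] →
                    a' ≢ b' → a ⋖ a' → b ⋖ b' → NormalAt i
  normal-at-pairs {i} {a} {b} {a'} {b'} Pᵢ Pᵢ₊₁ a'≢b' a⋖a' b⋖b' A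
    rewrite Pᵢ | Pᵢ₊₁ = *-monoˡ-≤ 2 matched
    where
    a'∈P : a' ∈ elems
    a'∈P = proj₁ (pair-level-members Pᵢ₊₁)
    b'∈P : b' ∈ elems
    b'∈P = proj₂ (pair-level-members Pᵢ₊₁)
    matched : length (filter (λ x → A x Bool.≟ true) (a ∷ b ∷ [])) ≤
              length (∇ (filter (λ x → A x Bool.≟ true) (a ∷ b ∷ [])))
    matched with A a
    ... | false with A b
    ...   | false = z≤n
    ...   | true  = length-≥1 (∈-∇ b'∈P (here refl) b⋖b')
    matched | true with A b
    ...   | false = length-≥1 (∈-∇ a'∈P (here refl) a⋖a')
    ...   | true  = length-≥2 (∈-∇ a'∈P (here refl) a⋖a') (∈-∇ b'∈P (there (here refl)) b⋖b') a'≢b'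

module Chains (k : ℕ) = FinGradedPoset I₁[ k ]

tops : (k : ℕ) → List (Vec I₁ k)
tops k = replicate k e₁ ∷ replicate k e₁' ∷ []

chainsAbove : I₁ → (k : ℕ) → List (Vec I₁ k)
chainsAbove x k = filter (λ v → isMultichain? (x ∷ v)) (allVecs k)

extend-comparable : ∀ {k} {x y} → x ≤I y → (vs : List (Vec I₁ k)) →
  filter (λ v → isMultichain? (x ∷ v)) (map (y ∷_) vs)
    ≡ map (y ∷_) (filter (λ v → isMultichain? (y ∷ v)) vs)
extend-comparable {x = x} {y} x≤y vs =
  trans (filter-map-comm (λ v → isMultichain? (x ∷ v)) (y ∷_) vs)
        (cong (map (y ∷_)) (filter-≐ _ _ (proj₂ , (x≤y ,_)) vs))

extend-incomparable : ∀ {k} {x y} → ¬ (x ≤I y) → (vs : List (Vec I₁ k)) →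
  filter (λ v → isMultichain? (x ∷ v)) (map (y ∷_) vs) ≡ []
extend-incomparable {x = x} {y} x≰y vs =
  trans (filter-map-comm (λ v → isMultichain? (x ∷ v)) (y ∷_) vs)
        (cong (map (y ∷_)) (filter-none _ (All.universal (λ _ → x≰y ∘ proj₁) vs)))

chainsAbove-suc : ∀ x k → chainsAbove x (suc k) ≡
  filter (λ v → isMultichain? (x ∷ v)) (map (∅ ∷_) (allVecs k)) ++
  filter (λ v → isMultichain? (x ∷ v)) (map (e₁ ∷_) (allVecs k)) ++
  filter (λ v → isMultichain? (x ∷ v)) (map (e₁' ∷_) (allVecs k))
chainsAbove-suc x k =
  trans (filter-++ P? (map (∅ ∷_) V) _)
        (cong (filter P? (map (∅ ∷_) V) ++_)
              (trans (filter-++ P? (map (e₁ ∷_) V) _)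
                     (cong (filter P? (map (e₁ ∷_) V) ++_)
                           (trans (filter-++ P? (map (e₁' ∷_) V) []) (++-identityʳ _)))))
  where
  V : List (Vec I₁ k)
  V = allVecs k
  P? : Decidable (λ (v : Vec I₁ (suc k)) → IsMultichain (x ∷ v))
  P? v = isMultichain? (x ∷ v)

data Atom : I₁ → Set where
  atom₁  : Atom e₁
  atom₁' : Atom e₁'

chainsAbove-atom : ∀ {a} → Atom a → ∀ k → chainsAbove a k ≡ replicate k a ∷ []
chainsAbove-atom atom₁ zero = refl
chainsAbove-atom atom₁' zero = refl
chainsAbove-atom atom₁ (suc k)
  rewrite chainsAbove-suc e₁ k
        | extend-incomparable {x = e₁} {∅} (λ ()) (allVecs k)
        | extend-comparable e≤e (allVecs k)
        | extend-incomparable {x = e₁} {e₁'} (λ ()) (allVecs k)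
        | chainsAbove-atom atom₁ k = refl
chainsAbove-atom atom₁' (suc k)
  rewrite chainsAbove-suc e₁' k
        | extend-incomparable {x = e₁'} {∅} (λ ()) (allVecs k)
        | extend-incomparable {x = e₁'} {e₁} (λ ()) (allVecs k)
        | extend-comparable e'≤e' (allVecs k)
        | chainsAbove-atom atom₁' k = refl

multichain-above-∅ : ∀ {k} (v : Vec I₁ k) → IsMultichain v → IsMultichain (∅ ∷ v)
multichain-above-∅ [] _ = tt
multichain-above-∅ (y ∷ ys) mc = ∅≤ , mc

elems≡chainsAbove-∅ : ∀ k → Chains.elems k ≡ chainsAbove ∅ k
elems≡chainsAbove-∅ k = filter-≐ _ _ (multichain-above-∅ _ , forget) (allVecs k)
  where
  forget : ∀ {v : Vec I₁ k} → IsMultichain (∅ ∷ v) → IsMultichain v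
  forget {[]} _ = tt
  forget {y ∷ ys} = proj₂

elems-suc : ∀ k → Chains.elems (suc k) ≡ map (∅ ∷_) (Chains.elems k) ++ tops (suc k)
elems-suc k
  rewrite elems≡chainsAbove-∅ (suc k) | elems≡chainsAbove-∅ k
        | chainsAbove-suc ∅ k
        | extend-comparable {x = ∅} {∅} ∅≤ (allVecs k)
        | extend-comparable {x = ∅} {e₁} ∅≤ (allVecs k)
        | extend-comparable {x = ∅} {e₁'} ∅≤ (allVecs k)
        | chainsAbove-atom atom₁ k | chainsAbove-atom atom₁' k = refl

rank : ∀ {k} → Vec I₁ k → ℕ
rank v = Vec.sum (Vec.map ρI v)

atom-rank : ∀ {a} → Atom a → ρI a ≡ 1
atom-rank atom₁ = refl
atom-rank atom₁' = refl

rank-bounded : ∀ {k} (v : Vec I₁ k) → rank v ≤ k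
rank-bounded [] = z≤n
rank-bounded (∅ ∷ v) = m≤n⇒m≤1+n (rank-bounded v)
rank-bounded (e₁ ∷ v) = s≤s (rank-bounded v)
rank-bounded (e₁' ∷ v) = s≤s (rank-bounded v)

rank-mono : ∀ {k} {v w : Vec I₁ k} → Pointwise _≤I_ v w → rank v ≤ rank w
rank-mono [] = z≤n
rank-mono (∅≤ {∅} ∷ p) = rank-mono p
rank-mono (∅≤ {e₁} ∷ p) = m≤n⇒m≤1+n (rank-mono p)
rank-mono (∅≤ {e₁'} ∷ p) = m≤n⇒m≤1+n (rank-mono p)
rank-mono (e≤e ∷ p) = s≤s (rank-mono p)
rank-mono (e'≤e' ∷ p) = s≤s (rank-mono p)

rank-strict : ∀ {k} {v w : Vec I₁ k} → Pointwise _≤I_ v w → v ≢ w → rank v < rank w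
rank-strict [] v≢w = ⊥-elim (v≢w refl)
rank-strict (∅≤ {∅} ∷ p) v≢w = rank-strict p (v≢w ∘ cong (∅ ∷_))
rank-strict (∅≤ {e₁} ∷ p) _ = s≤s (rank-mono p)
rank-strict (∅≤ {e₁'} ∷ p) _ = s≤s (rank-mono p)
rank-strict (e≤e ∷ p) v≢w = s≤s (rank-strict p (v≢w ∘ cong (e₁ ∷_)))
rank-strict (e'≤e' ∷ p) v≢w = s≤s (rank-strict p (v≢w ∘ cong (e₁' ∷_)))

-- The tower ∅…∅ x…x of length k with i copies of x (for i ≤ k).
tower : (k : ℕ) → ℕ → I₁ → Vec I₁ k
tower zero i x = []
tower (suc k) i x = (if k <ᵇ i then x else ∅) ∷ tower k i x

tower-low : ∀ {k i} x → i ≤ k → tower (suc k) i x ≡ ∅ ∷ tower k i x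
tower-low {k} {i} x i≤k with k <ᵇ i in eq
... | false = refl
... | true = ⊥-elim (<⇒≱ (<ᵇ⇒< k i (subst Bool.T (sym eq) tt)) i≤k)

tower-full : ∀ {k i} x → k ≤ i → tower k i x ≡ replicate k x
tower-full {zero} x _ = refl
tower-full {suc k} {i} x k<i with k <ᵇ i | <⇒<ᵇ k<i
... | true | _ = cong (x ∷_) (tower-full x (<⇒≤ k<i))

tower-zero : ∀ k x y → tower k 0 x ≡ tower k 0 y
tower-zero zero x y = refl
tower-zero (suc k) x y = cong (∅ ∷_) (tower-zero k x y)

rank-replicate : ∀ {a} → Atom a → ∀ k → rank (replicate k a) ≡ k
rank-replicate atom zero = refl
rank-replicate atom (suc k) rewrite atom-rank atom = cong suc (rank-replicate atom k)

rank-tower : ∀ {a} → Atom a → ∀ {k i} → i ≤ k → rank (tower k i a) ≡ i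
rank-tower atom {zero} z≤n = refl
rank-tower {a} atom {suc k} {i} i≤1+k with i ≤? k
... | yes i≤k = trans (cong rank (tower-low a i≤k)) (rank-tower atom i≤k)
... | no i≰k with ≤-antisym i≤1+k (≰⇒> i≰k)
...   | refl = trans (cong rank (tower-full {suc k} a ≤-refl)) (rank-replicate atom (suc k))

≤I-refl : ∀ x → x ≤I x
≤I-refl ∅ = ∅≤
≤I-refl e₁ = e≤e
≤I-refl e₁' = e'≤e'

tower-mono : ∀ {k i j} x → i ≤ j → Pointwise _≤I_ (tower k i x) (tower k j x)
tower-mono {zero} x _ = []
tower-mono {suc k} {i} {j} x i≤j with k <ᵇ i | <ᵇ⇒< k i | k <ᵇ j | <⇒<ᵇ {k} {j}
... | true  | k<i | true  | _   = ≤I-refl x ∷ tower-mono x i≤j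
... | true  | k<i | false | k≮j = ⊥-elim (k≮j (<-≤-trans (k<i tt) i≤j))
... | false | _   | _     | _   = ∅≤ ∷ tower-mono x i≤j

towers-distinct : ∀ {k i} → 1 ≤ i → i ≤ k → tower k i e₁ ≢ tower k i e₁'
towers-distinct {zero} {suc i} _ ()
towers-distinct {suc k} {i} 1≤i i≤1+k with i ≤? k
... | yes i≤k rewrite tower-low {k} e₁ i≤k | tower-low {k} e₁' i≤k =
  towers-distinct 1≤i i≤k ∘ cong Vec.tail
... | no i≰k rewrite ≤-antisym i≤1+k (≰⇒> i≰k)
                   | tower-full {suc k} {suc k} e₁ ≤-refl | tower-full {suc k} {suc k} e₁' ≤-refl = λ ()

hasRank? : ∀ {k} i → Decidable (λ (v : Vec I₁ k) → rank v ≡ i)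
hasRank? i v = rank v ≟ i

level-suc : ∀ k i → Chains.level (suc k) i ≡
  map (∅ ∷_) (Chains.level k i) ++ filter (hasRank? i) (tops (suc k))
level-suc k i rewrite elems-suc k =
  trans (filter-++ (hasRank? i) (map (∅ ∷_) (Chains.elems k)) (tops (suc k)))
        (cong (_++ filter (hasRank? i) (tops (suc k)))
              (filter-map-comm (hasRank? i) (∅ ∷_) (Chains.elems k)))

tops-rejected : ∀ {k i} → i ≢ k → filter (hasRank? i) (tops k) ≡ []
tops-rejected {k} {i} i≢k =
  trans (filter-reject (hasRank? i) {replicate k e₁} (wrong-rank atom₁))
        (filter-reject (hasRank? i) {replicate k e₁'} {[]} (wrong-rank atom₁'))
  where
  wrong-rank : ∀ {a} → Atom a → rank (replicate k a) ≢ i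
  wrong-rank atom eq = i≢k (trans (sym eq) (rank-replicate atom k))

tops-accepted : ∀ k → filter (hasRank? k) (tops k) ≡ tops k
tops-accepted k =
  trans (filter-accept (hasRank? k) {replicate k e₁} (rank-replicate atom₁ k))
        (cong (replicate k e₁ ∷_)
              (filter-accept (hasRank? k) {replicate k e₁'} {[]} (rank-replicate atom₁' k)))

level-zero : ∀ k → Chains.level k 0 ≡ tower k 0 e₁ ∷ []
level-zero zero = refl
level-zero (suc k) rewrite level-suc k 0 | level-zero k | tops-rejected {suc k} {0} (λ ()) = refl

level-above : ∀ k {i} → k < i → Chains.level k i ≡ []
level-above zero {suc i} _ = refl
level-above (suc k) {i} k<i
  rewrite level-suc k i | level-above k (<-trans (n<1+n k) k<i)
        | tops-rejected {suc k} {i} (λ i≡1+k → <-irrefl (sym i≡1+k) k<i) = refl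

level-middle : ∀ k {i} → 1 ≤ i → i ≤ k → Chains.level k i ≡ tower k i e₁ ∷ tower k i e₁' ∷ []
level-middle zero {suc i} _ ()
level-middle (suc k) {i} 1≤i i≤1+k with i ≤? k
... | yes i≤k
  rewrite level-suc k i | level-middle k 1≤i i≤k
        | tops-rejected {suc k} {i} (λ i≡1+k → <-irrefl i≡1+k (s≤s i≤k))
        | tower-low e₁ i≤k | tower-low e₁' i≤k = refl
... | no i≰k with ≤-antisym i≤1+k (≰⇒> i≰k)
...   | refl
  rewrite level-suc k (suc k) | level-above k ≤-refl | tops-accepted (suc k)
        | tower-full {suc k} e₁ ≤-refl | tower-full {suc k} e₁' ≤-refl = refl

level-size-≤2 : ∀ k i → Chains.∣P_∣ k i ≤ 2
level-size-≤2 k zero rewrite level-zero k = s≤s z≤n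
level-size-≤2 k (suc i) with suc i ≤? k
... | yes 1+i≤k rewrite level-middle k (s≤s z≤n) 1+i≤k = ≤-refl
... | no 1+i≰k rewrite level-above k (≰⇒> 1+i≰k) = z≤n

tower-cover : ∀ {a} → Atom a → ∀ {k i} → suc i ≤ k →
              Chains._⋖_ k (tower k i a) (tower k (suc i) a)
tower-cover {a} atom {k} {i} 1+i≤k =
  Graded.cover-by-rank I₁[ k ] (λ (v≤w , v≢w) → rank-strict v≤w v≢w)
    (tower-mono a (n≤1+n i))
    (trans (rank-tower atom 1+i≤k) (cong suc (sym (rank-tower atom (<⇒≤ 1+i≤k)))))

normal-at-zero : ∀ k → 1 ≤ k → Graded.NormalAt I₁[ k ] 0
normal-at-zero k 1≤k =
  Graded.normal-at-singleton I₁[ k ] (level-zero k) (level-middle k ≤-refl 1≤k)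
    (towers-distinct ≤-refl 1≤k) (tower-cover atom₁ 1≤k) bottom⋖tower₁'
  where
  bottom⋖tower₁' : Chains._⋖_ k (tower k 0 e₁) (tower k 1 e₁')
  bottom⋖tower₁' = subst (λ v → Chains._⋖_ k v (tower k 1 e₁')) (tower-zero k e₁' e₁)
                         (tower-cover atom₁' 1≤k)

normal-at-positive : ∀ k {i} → 1 ≤ i → suc i ≤ k → Graded.NormalAt I₁[ k ] i
normal-at-positive k 1≤i 1+i≤k =
  Graded.normal-at-pairs I₁[ k ] (level-middle k 1≤i (<⇒≤ 1+i≤k)) (level-middle k (s≤s z≤n) 1+i≤k)
    (towers-distinct (s≤s z≤n) 1+i≤k) (tower-cover atom₁ 1+i≤k) (tower-cover atom₁' 1+i≤k)

-- Log-concavity at 1 ≤ i < k: the levels i and i+1 have two elements,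
-- and no level has more.
log-concave-at : ∀ k {i} → 1 ≤ i → suc i ≤ k →
  Chains.∣P_∣ k (i ∸ 1) * Chains.∣P_∣ k (suc i) ≤ Chains.∣P_∣ k i * Chains.∣P_∣ k i
log-concave-at k 1≤i 1+i≤k
  rewrite level-middle k 1≤i (<⇒≤ 1+i≤k) | level-middle k (s≤s z≤n) 1+i≤k =
  *-monoˡ-≤ 2 (level-size-≤2 k _)

lemma2p13 : (k : ℕ) → FinGradedPoset.Normal I₁[ k ] × FinGradedPoset.RankLogConcave I₁[ k ]
lemma2p13 k = normal , log-concave
  where
  rankP≤k : Chains.rankP k ≤ k
  rankP≤k = Graded.rankP-≤ I₁[ k ] rank-bounded

  normal : FinGradedPoset.Normal I₁[ k ]
  normal zero    0<rankP = normal-at-zero k (<-≤-trans 0<rankP rankP≤k)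
  normal (suc i) i<rankP = normal-at-positive k (s≤s z≤n) (<-≤-trans i<rankP rankP≤k)

  log-concave : FinGradedPoset.RankLogConcave I₁[ k ]
  log-concave i 1≤i i<rankP = log-concave-at k 1≤i (<-≤-trans i<rankP rankP≤k)
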